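{- A Lloyd–Topor program $\Pi$ is tight if and only if there exists a natural number $n$ such that the rule dependency graph of $\Pi$ has no paths of length $n$.
   Context: Formulas are first-order formulas (with equality) built from atomic formulas and $\bot$ using $\land,\lor,\rightarrow,\forall,\exists$; $\neg F$ abbreviates $F\rightarrow\bot$. A Lloyd–Topor program is a finite set of rules $p(\mathbf t)\leftarrow G$, where $p$ is a predicate constant other than equality, $\mathbf t$ a tuple of terms and $G$ a formula (the body). An occurrence of an expression in a formula is negated if it belongs to a subformula of the form $F\rightarrow\bot$, nonnegated otherwise; it is positive if the number of implications containing it in their antecedent is even. The predicate dependency graph of $\Pi$ has as vertices the predicate constants occurring in $\Pi$, and an edge from $p$ to $q$ whenever $\Pi$ has a rule with $p$ in the head whose body has a positive nonnegated occurrence of $q$; $\Pi$ is tight if this graph is acyclic. The rule dependency graph of $\Pi$ has as vertices the rules of $\Pi$ with variables (free and bound) renamed arbitrarily, and an edge from $p(\mathbf t)\leftarrow G$ to $p'(\mathbf t')\leftarrow G'$, labeled $p'(\mathbf s)$, whenever the atomic formula $p'(\mathbf s)$ has a positive nonnegated occurrence in $G$. The length of a path is its number of edges. -}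

module Defs where

open import Data.Nat using (ℕ; zero; suc)
open import Data.Bool using (Bool; true; false; not)
open import Data.List using (List; []; _∷_)
open import Data.List.Membership.Propositional using (_∈_)
open import Data.Product using (Σ; Σ-syntax; ∃; ∃-syntax; _×_; _,_)
open import Relation.Nullary using (¬_)
open import Relation.Binary.PropositionalEquality using (_≡_)
open import Relation.Binary.Construct.Closure.Transitive using (TransClosure)
open import Function.Definitions using (Injective)

data Term (F : Set) : Set where
  var : ℕ → Term F
  fn  : F → List (Term F) → Term F

-- First-order formulas with equality over predicate constants P.
-- Equality is a separate constructor, so predicate constants in P are
-- automatically "other than equality".
data Formula (P F : Set) : Set where
  atom      : P → List (Term F) → Formula P F
  _≐_       : Term F → Term F → Formula P F
  ⊥'        : Formula P F
  _∧'_      : Formula P F → Formula P F → Formula P F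
  _∨'_      : Formula P F → Formula P F → Formula P F
  _⇒'_      : Formula P F → Formula P F → Formula P F
  ∀'        : ℕ → Formula P F → Formula P F
  ∃'        : ℕ → Formula P F → Formula P F

¬' : {P F : Set} → Formula P F → Formula P F
¬' G = G ⇒' ⊥'

record Rule (P F : Set) : Set where
  constructor _⟨_⟩←_
  field
    head : P
    args : List (Term F)
    body : Formula P F
open Rule public

Program : Set → Set → Set
Program P F = List (Rule P F)

-- Occ b G (p , s): the atomic formula p(s) has a nonnegated occurrence in G,
-- which is positive if b = true and negative if b = false
-- (b tracks the parity of the number of implications having the occurrence
-- in their antecedent; entering the antecedent of an implication of the form
-- H → ⊥ is forbidden, as such occurrences are negated).
data Occ {P F : Set} : Bool → Formula P F → P × List (Term F) → Set where
  here  : ∀ {p s} → Occ true (atom p s) (p , s)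
  ∧ˡ    : ∀ {b G H a} → Occ b G a → Occ b (G ∧' H) a
  ∧ʳ    : ∀ {b G H a} → Occ b H a → Occ b (G ∧' H) a
  ∨ˡ    : ∀ {b G H a} → Occ b G a → Occ b (G ∨' H) a
  ∨ʳ    : ∀ {b G H a} → Occ b H a → Occ b (G ∨' H) a
  ⇒ˡ    : ∀ {b G H a} → ¬ (H ≡ ⊥') → Occ (not b) G a → Occ b (G ⇒' H) a
  ⇒ʳ    : ∀ {b G H a} → Occ b H a → Occ b (G ⇒' H) a
  ∀'    : ∀ {b x G a} → Occ b G a → Occ b (∀' x G) a
  ∃'    : ∀ {b x G a} → Occ b G a → Occ b (∃' x G) a

PosNonneg : {P F : Set} → P → List (Term F) → Formula P F → Set
PosNonneg p s G = Occ true G (p , s)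

PredEdge : {P F : Set} → Program P F → P → P → Set
PredEdge {P} {F} Π p q =
  Σ[ r ∈ Rule P F ] (r ∈ Π × head r ≡ p × Σ[ s ∈ List (Term F) ] PosNonneg q s (body r))

Tight : {P F : Set} → Program P F → Set
Tight {P} Π = (p : P) → ¬ TransClosure (PredEdge Π) p p

mutual
  renTerm : {F : Set} → (ℕ → ℕ) → Term F → Term F
  renTerm ρ (var x)   = var (ρ x)
  renTerm ρ (fn f ts) = fn f (renTerms ρ ts)

  renTerms : {F : Set} → (ℕ → ℕ) → List (Term F) → List (Term F)
  renTerms ρ []       = []
  renTerms ρ (t ∷ ts) = renTerm ρ t ∷ renTerms ρ ts

renFormula : {P F : Set} → (ℕ → ℕ) → Formula P F → Formula P F
renFormula ρ (atom p ts) = atom p (renTerms ρ ts)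
renFormula ρ (t ≐ u)     = renTerm ρ t ≐ renTerm ρ u
renFormula ρ ⊥'          = ⊥'
renFormula ρ (G ∧' H)    = renFormula ρ G ∧' renFormula ρ H
renFormula ρ (G ∨' H)    = renFormula ρ G ∨' renFormula ρ H
renFormula ρ (G ⇒' H)    = renFormula ρ G ⇒' renFormula ρ H
renFormula ρ (∀' x G)    = ∀' (ρ x) (renFormula ρ G)
renFormula ρ (∃' x G)    = ∃' (ρ x) (renFormula ρ G)

renRule : {P F : Set} → (ℕ → ℕ) → Rule P F → Rule P F
renRule ρ (p ⟨ ts ⟩← G) = p ⟨ renTerms ρ ts ⟩← renFormula ρ G

RDVertex : {P F : Set} → Program P F → Set
RDVertex {P} {F} Π =
  Σ[ r ∈ Rule P F ] Σ[ r₀ ∈ Rule P F ] Σ[ ρ ∈ (ℕ → ℕ) ]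
    (r₀ ∈ Π × Injective _≡_ _≡_ ρ × r ≡ renRule ρ r₀)

rule : {P F : Set} {Π : Program P F} → RDVertex Π → Rule P F
rule (r , _) = r

RDEdge : {P F : Set} (Π : Program P F) → RDVertex Π → RDVertex Π → Set
RDEdge {P} {F} Π v w =
  Σ[ s ∈ List (Term F) ] PosNonneg (head (rule {Π = Π} w)) s (body (rule {Π = Π} v))

-- paths of length n (number of edges)
data RDPath {P F : Set} (Π : Program P F) : ℕ → RDVertex Π → RDVertex Π → Set where
  []  : ∀ {v} → RDPath Π zero v v
  _∷_ : ∀ {n u v w} → RDEdge Π u v → RDPath Π n v w → RDPath Π (suc n) u w

NoPathsOfLength : {P F : Set} → Program P F → ℕ → Set
NoPathsOfLength Π n = ¬ (Σ[ v ∈ RDVertex Π ] Σ[ w ∈ RDVertex Π ] RDPath Π n v w)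

-- Every edge of the rule dependency graph, read through the rules it connects, is an
-- edge of the predicate dependency graph between their heads.  Tagging each vertex
-- with the position in Π of the rule it renames, a path of length |Π| would visit
-- |Π| + 1 positions, so two of them coincide; when the predicate graph is acyclic the
-- positions along a path are pairwise distinct, hence there is no such path.
-- Conversely, an edge p → q of the predicate graph comes from a rule r with head p,
-- and r (under the identity renaming) has an edge to every vertex with head q, so a
-- cycle through p unrolls into paths of the rule graph of every length.
module Submission where

open import Level using (Level; _⊔_)
open import Data.Nat using (ℕ; zero; suc; _≤_; _+_; z≤n; s≤s)
open import Data.Nat.Properties using (≤-trans; m≤n+m; 1+n≰n)
open import Data.Product using (Σ-syntax; ∃-syntax; ∃₂; _×_; _,_; map₂)
open import Data.Bool using (Bool)
open import Data.Sum using (_⊎_; inj₁; inj₂)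
open import Data.List using (List; []; _∷_; length; lookup)
open import Data.List.Membership.Propositional using (_∈_)
open import Data.List.Relation.Unary.Any using (index)
open import Data.List.Relation.Unary.Any.Properties using (lookup-index)
open import Data.Fin using (Fin)
open import Data.Fin.Properties using (injective⇒≤)
open import Data.Vec using (Vec; []; _∷_)
open import Data.Vec.Relation.Unary.All as All using (All; []; _∷_)
open import Data.Vec.Relation.Unary.AllPairs using ([]; _∷_)
open import Data.Vec.Relation.Unary.Unique.Propositional using (Unique)
open import Data.Vec.Relation.Unary.Unique.Propositional.Properties using (lookup-injective)
open import Function.Base using (_on_)
open import Function.Bundles using (_⇔_; mk⇔)
open import Relation.Binary.Core using (Rel; _=[_]⇒_)
open import Relation.Binary.Construct.Closure.Transitive using (TransClosure; [_]; _∷_)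
open import Relation.Binary.PropositionalEquality using (_≡_; refl; sym; cong; cong₂; subst)
open import Relation.Nullary using (¬_)
open import Defs

private variable
  a b ℓ ℓ′ : Level
  A : Set a
  B : Set b
  m n k : ℕ

data Walk {A : Set a} (R : Rel A ℓ) : ℕ → Rel A (a ⊔ ℓ) where
  []  : ∀ {x} → Walk R zero x x
  _∷_ : ∀ {n x y z} → R x y → Walk R n y z → Walk R (suc n) x z

Acyclic : {A : Set a} → Rel A ℓ → Set (a ⊔ ℓ)
Acyclic R = ∀ x → ¬ TransClosure R x x

module _ {R : Rel A ℓ} where

  _++ʷ_ : ∀ {x y z} → Walk R m x y → Walk R n y z → Walk R (m + n) x z
  []      ++ʷ w′ = w′
  (r ∷ w) ++ʷ w′ = r ∷ (w ++ʷ w′)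

  Walk-take : ∀ {x y} → n ≤ k → Walk R k x y → ∃[ z ] Walk R n x z
  Walk-take z≤n       w       = _ , []
  Walk-take (s≤s n≤k) (r ∷ w) = map₂ (r ∷_) (Walk-take n≤k w)

  Walk-map : {S : Rel B ℓ′} (f : A → B) → R =[ f ]⇒ S →
             ∀ {x y} → Walk R n x y → Walk S n (f x) (f y)
  Walk-map f R⇒S []      = []
  Walk-map f R⇒S (r ∷ w) = R⇒S r ∷ Walk-map f R⇒S w

  vertices : ∀ {x y} → Walk R n x y → Vec A (suc n)
  vertices {x = x} []      = x ∷ []
  vertices {x = x} (_ ∷ w) = x ∷ vertices w

  vertices-reachable : ∀ {x y} (w : Walk R n x y) →
                       All (λ z → x ≡ z ⊎ TransClosure R x z) (vertices w)
  vertices-reachable []      = inj₁ refl ∷ []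
  vertices-reachable (r ∷ w) = inj₁ refl ∷ All.map extend (vertices-reachable w)
    where
    extend : ∀ {z} → _ ≡ z ⊎ TransClosure R _ z → _ ≡ z ⊎ TransClosure R _ z
    extend (inj₁ refl) = inj₂ [ r ]
    extend (inj₂ r⁺)   = inj₂ (r ∷ r⁺)

  Acyclic⇒vertices-unique : Acyclic R → ∀ {x y} (w : Walk R n x y) → Unique (vertices w)
  Acyclic⇒vertices-unique acyclic     []      = [] ∷ []
  Acyclic⇒vertices-unique acyclic {x} (r ∷ w) =
    All.map later≢x (vertices-reachable w) ∷ Acyclic⇒vertices-unique acyclic w
    where
    later≢x : ∀ {z} → _ ≡ z ⊎ TransClosure R _ z → ¬ x ≡ z
    later≢x (inj₁ refl) refl = acyclic x [ r ]
    later≢x (inj₂ r⁺)   refl = acyclic x (r ∷ r⁺)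

  TransClosure-on : (f : B → A) → ∀ {x y} → TransClosure (R on f) x y → TransClosure R (f x) (f y)
  TransClosure-on f [ r ]    = [ r ]
  TransClosure-on f (r ∷ r⁺) = r ∷ TransClosure-on f r⁺

  Acyclic-on : Acyclic R → (f : B → A) → Acyclic (R on f)
  Acyclic-on acyclic f x cycle = acyclic (f x) (TransClosure-on f cycle)

Acyclic⇒¬Walk-of-size : {R : Rel (Fin m) ℓ} → Acyclic R → ∀ {i j} → ¬ Walk R m i j
Acyclic⇒¬Walk-of-size acyclic w =
  1+n≰n (injective⇒≤ (lookup-injective (Acyclic⇒vertices-unique acyclic w) _ _))

Lifts : {A : Set a} {B : Set b} (f : B → A) → Rel A ℓ → Rel B ℓ′ → Set (a ⊔ b ⊔ ℓ ⊔ ℓ′)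
Lifts {B = B} f R S =
  ∀ {a a′} → R a a′ → Σ[ b ∈ B ] (f b ≡ a × (∀ {b′} → f b′ ≡ a′ → S b b′))

module _ {f : B → A} {R : Rel A ℓ} {S : Rel B ℓ′} (lift : Lifts f R S) where

  TransClosure-lift : ∀ {a a′ b′} → TransClosure R a a′ → f b′ ≡ a′ →
                      Σ[ b ∈ B ] (f b ≡ a × ∃[ k ] Walk S (suc k) b b′)
  TransClosure-lift [ r ] fb′≡a′ =
    let b , fb≡a , S-to = lift r in b , fb≡a , zero , S-to fb′≡a′ ∷ []
  TransClosure-lift (r ∷ r⁺) fb′≡a′ =
    let b₁ , fb₁≡a₁ , k , w = TransClosure-lift r⁺ fb′≡a′
        b , fb≡a , S-to = lift r
    in b , fb≡a , suc k , S-to fb₁≡a₁ ∷ w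

  cycle⇒unbounded-walks : ∀ {a} → TransClosure R a a → ∀ n →
                          Σ[ b ∈ B ] (f b ≡ a × Σ[ k ∈ ℕ ] (n ≤ k × ∃[ b′ ] Walk S k b b′))
  cycle⇒unbounded-walks [ r ]  zero = let b , fb≡a , _ = lift r in b , fb≡a , zero , z≤n , b , []
  cycle⇒unbounded-walks (r ∷ _)  zero = let b , fb≡a , _ = lift r in b , fb≡a , zero , z≤n , b , []
  cycle⇒unbounded-walks cycle (suc n) =
    let b , fb≡a , k , n≤k , b′ , w = cycle⇒unbounded-walks cycle n
        b₀ , fb₀≡a , j , w₀        = TransClosure-lift cycle fb≡a
    in b₀ , fb₀≡a , suc j + k , s≤s (≤-trans n≤k (m≤n+m k j)) , b′ , w₀ ++ʷ w

  cycle⇒walks : ∀ {a} → TransClosure R a a → ∀ n → ∃₂ λ b b′ → Walk S n b b′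
  cycle⇒walks cycle n =
    let b , _ , k , n≤k , _ , w = cycle⇒unbounded-walks cycle n
    in b , Walk-take n≤k w

mutual
  renTerm-id : {F : Set} (t : Term F) → renTerm (λ x → x) t ≡ t
  renTerm-id (var x)   = refl
  renTerm-id (fn f ts) = cong (fn f) (renTerms-id ts)

  renTerms-id : {F : Set} (ts : List (Term F)) → renTerms (λ x → x) ts ≡ ts
  renTerms-id []       = refl
  renTerms-id (t ∷ ts) = cong₂ _∷_ (renTerm-id t) (renTerms-id ts)

renFormula-id : {P F : Set} (G : Formula P F) → renFormula (λ x → x) G ≡ G
renFormula-id (atom p ts) = cong (atom p) (renTerms-id ts)
renFormula-id (t ≐ u)     = cong₂ _≐_ (renTerm-id t) (renTerm-id u)
renFormula-id ⊥'          = refl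
renFormula-id (G ∧' H)    = cong₂ _∧'_ (renFormula-id G) (renFormula-id H)
renFormula-id (G ∨' H)    = cong₂ _∨'_ (renFormula-id G) (renFormula-id H)
renFormula-id (G ⇒' H)    = cong₂ _⇒'_ (renFormula-id G) (renFormula-id H)
renFormula-id (∀' x G)    = cong (∀' x) (renFormula-id G)
renFormula-id (∃' x G)    = cong (∃' x) (renFormula-id G)

renRule-id : {P F : Set} (r : Rule P F) → renRule (λ x → x) r ≡ r
renRule-id (p ⟨ ts ⟩← G) = cong₂ (p ⟨_⟩←_) (renTerms-id ts) (renFormula-id G)

Occ-unrename : {P F : Set} (ρ : ℕ → ℕ) {b : Bool} (G : Formula P F) {p : P} {s : List (Term F)} →
               Occ b (renFormula ρ G) (p , s) → ∃[ s′ ] Occ b G (p , s′)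
Occ-unrename ρ (atom q ts) here        = ts , here
Occ-unrename ρ (G ∧' H)    (∧ˡ o)      = map₂ ∧ˡ (Occ-unrename ρ G o)
Occ-unrename ρ (G ∧' H)    (∧ʳ o)      = map₂ ∧ʳ (Occ-unrename ρ H o)
Occ-unrename ρ (G ∨' H)    (∨ˡ o)      = map₂ ∨ˡ (Occ-unrename ρ G o)
Occ-unrename ρ (G ∨' H)    (∨ʳ o)      = map₂ ∨ʳ (Occ-unrename ρ H o)
Occ-unrename ρ (G ⇒' H)    (⇒ˡ H≢⊥ o) = map₂ (⇒ˡ λ { refl → H≢⊥ refl }) (Occ-unrename ρ G o)
Occ-unrename ρ (G ⇒' H)    (⇒ʳ o)      = map₂ ⇒ʳ (Occ-unrename ρ H o)
Occ-unrename ρ (∀' x G)    (∀' o)      = map₂ ∀' (Occ-unrename ρ G o)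
Occ-unrename ρ (∃' x G)    (∃' o)      = map₂ ∃' (Occ-unrename ρ G o)

module _ {P F : Set} (Π : Program P F) where

  ruleHead : RDVertex Π → P
  ruleHead v = head (rule {Π = Π} v)

  positionHead : Fin (length Π) → P
  positionHead i = head (lookup Π i)

  position : RDVertex Π → Fin (length Π)
  position (_ , _ , _ , r₀∈Π , _) = index r₀∈Π

  ruleHead-position : (v : RDVertex Π) → ruleHead v ≡ positionHead (position v)
  ruleHead-position (_ , (p ⟨ ts ⟩← G) , ρ , r₀∈Π , _ , refl) = cong head (lookup-index r₀∈Π)

  RDEdge⇒PredEdge-on-position : RDEdge Π =[ position ]⇒ (PredEdge Π on positionHead)
  RDEdge⇒PredEdge-on-position {_ , (p ⟨ ts ⟩← G) , ρ , r₀∈Π , _ , refl} {w} (s , occ) =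
    let s′ , occ′ = Occ-unrename ρ G occ
    in  p ⟨ ts ⟩← G , r₀∈Π , cong head (lookup-index r₀∈Π) , s′
      , subst (λ q → Occ _ G (q , s′)) (ruleHead-position w) occ′

  identityVertex : ∀ {r} → r ∈ Π → RDVertex Π
  identityVertex {r} r∈Π = r , r , (λ x → x) , r∈Π , (λ eq → eq) , sym (renRule-id r)

  PredEdge-lifts : Lifts ruleHead (PredEdge Π) (RDEdge Π)
  PredEdge-lifts (r , r∈Π , r-head , s , occ) =
    identityVertex r∈Π , r-head , λ {w} w-head → s , subst (λ q → Occ _ (body r) (q , s)) (sym w-head) occ

  toWalk : ∀ {v w} → RDPath Π n v w → Walk (RDEdge Π) n v w
  toWalk []       = []
  toWalk (e ∷ es) = e ∷ toWalk es

  fromWalk : ∀ {v w} → Walk (RDEdge Π) n v w → RDPath Π n v w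
  fromWalk []       = []
  fromWalk (e ∷ es) = e ∷ fromWalk es

  tight⇒noPathsOfLength : Tight Π → NoPathsOfLength Π (length Π)
  tight⇒noPathsOfLength tight (_ , _ , path) =
    Acyclic⇒¬Walk-of-size (Acyclic-on {R = PredEdge Π} tight positionHead)
      (Walk-map position (λ {v} {w} → RDEdge⇒PredEdge-on-position {v} {w}) (toWalk path))

  noPathsOfLength⇒tight : NoPathsOfLength Π n → Tight Π
  noPathsOfLength⇒tight {n} noPaths p cycle =
    let v , w , walk = cycle⇒walks PredEdge-lifts cycle n
    in noPaths (v , w , fromWalk walk)

proposition2 : {P F : Set} (Π : Program P F) →
    Tight Π ⇔ (∃[ n ] NoPathsOfLength Π n)
proposition2 Π =
  mk⇔ (λ tight → length Π , tight⇒noPathsOfLength Π tight)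
      (λ (_ , noPaths) → noPathsOfLength⇒tight Π noPaths)
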